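{- Let $\alpha,n\in\mathbb{N}$. The number of paths in $\mathcal{S}_n(\alpha)$ whose block decomposition consists of $n$ blocks, each equal to $\mathsf{D}$ or $\mathsf{N}\mathsf{E}$ (i.e. each of size 1), is \[\frac{2^n}{n}\binom{\alpha n}{n-1}=\frac{2^n}{(\alpha-1)n+1}\binom{\alpha n}{n}.\]
   Context: $\mathcal{S}_n(\alpha)$ is the set of lattice paths from $(0,0)$ to $(n,\alpha n)$ with steps $\mathsf{E}=(1,0)$, $\mathsf{N}=(0,1)$, $\mathsf{D}=(1,1)$ staying weakly above $y=\alpha x$. Block decomposition of $p\in\mathcal{S}_n(\alpha)$: walk along $p$ backwards from $(n,\alpha n)$ to $(0,0)$; at the current lattice point $(a,b)$ consider the step of $p$ ending at $(a,b)$. If it is $\mathsf{D}$, that step is a block of size 1 and one moves to $(a-1,b-1)$. If it is $\mathsf{E}$, let $(a-j,b-j)$ ($j\ge1$) be the last lattice point of $p$ before $(a,b)$ that lies on the line $y-x=b-a$; the portion of $p$ from $(a-j,b-j)$ to $(a,b)$ is a block of size $j$ (a Schröder path from $(0,0)$ to $(j,j)$ after translation, touching the diagonal only at its endpoints), and one moves to $(a-j,b-j)$. If it is $\mathsf{N}$, no block is formed and one moves to $(a,b-1)$. The process ends at $(0,0)$; the sizes of the blocks sum to $n$. The blocks of size 1 are exactly $\mathsf{D}$ and $\mathsf{N}\mathsf{E}$. -}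

module Defs where

open import Data.Nat using (ℕ; zero; suc; _+_; _*_; _≤ᵇ_; _≡ᵇ_)
import Data.Nat.Properties as ℕₚ
open import Data.Bool using (Bool; true; false; _∧_)
open import Data.List using (List; []; _∷_; reverse; replicate; length; concat; map; upTo; filterᵇ)
import Data.List.Properties as Listₚ
import Data.Maybe.Properties as Maybeₚ
open import Data.Maybe using (Maybe; just; nothing)
open import Data.Product using (_×_; _,_)
open import Relation.Nullary using (does)

data Step : Set where
  E N D : Step

Path : Set
Path = List Step

move : Step → ℕ × ℕ → ℕ × ℕ
move E (x , y) = (suc x , y)
move N (x , y) = (x , suc y)
move D (x , y) = (suc x , suc y)

aboveAndEndsFrom : ℕ → ℕ × ℕ → ℕ × ℕ → Path → Bool
aboveAndEndsFrom α (tx , ty) (x , y) [] = (α * x ≤ᵇ y) ∧ (x ≡ᵇ tx) ∧ (y ≡ᵇ ty)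
aboveAndEndsFrom α t (x , y) (s ∷ p) = (α * x ≤ᵇ y) ∧ aboveAndEndsFrom α t (move s (x , y)) p

inS : ℕ → ℕ → Path → Bool
inS α n p = aboveAndEndsFrom α (n , α * n) (0 , 0) p

-- We work on the REVERSED path (last step first).
-- `scan h j rs` walks backwards after an E step: (h+1) is the current value
-- of (y - x) minus the target value (b - a); j is the number of x-steps
-- (E or D) consumed so far.  It stops at the first earlier lattice point
-- on the line y - x = b - a and returns the block size j and the remaining
-- (reversed) path.
scan : ℕ → ℕ → List Step → Maybe (ℕ × List Step)
scan h       j []       = nothing
scan h       j (E ∷ rs) = scan (suc h) (suc j) rs
scan h       j (D ∷ rs) = scan h (suc j) rs
scan zero    j (N ∷ rs) = just (j , rs)
scan (suc h) j (N ∷ rs) = scan h j rs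

-- The list of block sizes, in the order they are produced (from the end of
-- the path backwards); `nothing` if the process gets stuck.  The fuel
-- argument is the length of the path (each round consumes ≥ 1 step).
blocksFuel : ℕ → List Step → Maybe (List ℕ)
blocksFuel _       []       = just []
blocksFuel zero    (_ ∷ _)  = nothing
blocksFuel (suc k) (D ∷ rs) with blocksFuel k rs
... | just bs = just (1 ∷ bs)
... | nothing = nothing
blocksFuel (suc k) (N ∷ rs) = blocksFuel k rs
blocksFuel (suc k) (E ∷ rs) with scan 0 1 rs
... | nothing = nothing
... | just (j , rest) with blocksFuel k rest
...   | just bs = just (j ∷ bs)
...   | nothing = nothing

blockSizes : Path → Maybe (List ℕ)
blockSizes p = blocksFuel (length p) (reverse p)

nUnitBlocks : ℕ → Path → Bool
nUnitBlocks n p = does (Maybeₚ.≡-dec (Listₚ.≡-dec ℕₚ._≟_) (blockSizes p) (just (replicate n 1)))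

words : ℕ → List Path
words zero    = [] ∷ []
words (suc k) = concat (map (λ w → (E ∷ w) ∷ (N ∷ w) ∷ (D ∷ w) ∷ []) (words k))

wordsUpTo : ℕ → List Path
wordsUpTo L = concat (map words (upTo (suc L)))

-- S_n(α) as an explicit list: every path to (n, α n) has length ≤ n + α n.
S : ℕ → ℕ → List Path
S α n = filterᵇ (inS α n) (wordsUpTo (n + α * n))

countUnitBlocks : ℕ → ℕ → ℕ
countUnitBlocks α n = length (filterᵇ (nUnitBlocks n) (S α n))

module Submission where

-- A path is read backwards (as the reversed list of its steps).  Its block
-- decomposition consists of unit blocks exactly when every E step is
-- immediately preceded by an N step, i.e. the path is a word in the blocks D
-- and NE together with free N steps; there are then as many blocks as
-- horizontal steps.  Counting such paths ending at (a , b) and staying weakly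
-- above y = αx by their last block gives a recursion
--     paths a (b+1) = paths a b + 2 · paths (a-1) b    when α a ≤ b + 1,
-- and paths a (b+1) = 0 below the line.  Its solution is the ballot-type formula
--     (b+1) · paths a b = (b+1 - α a) · 2^a · C(b+1, a),
-- proved by induction from Pascal's rule and absorption.  At the endpoint
-- (n , α n) this gives (αn+1) · T = 2^n · C(αn+1, n), and the two closed forms of
-- the theorem follow by absorption once more.

open import Defs
open import Data.Nat using (ℕ; zero; suc; _+_; _*_; _∸_; _^_; _≤_; _≤ᵇ_; _≡ᵇ_; z≤n; s≤s; _≤?_)
open import Data.Nat.Properties
open import Data.Nat.Combinatorics using (_C_; nCk+nC[k+1]≡[n+1]C[k+1]; nC1≡n; k>n⇒nCk≡0)
open import Data.Nat.Tactic.RingSolver using (solve-∀)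
open import Data.Bool using (Bool; true; false; _∧_; if_then_else_; T)
open import Data.Bool.Properties using (∧-assoc; ∧-zeroʳ; ∧-identityʳ)
open import Data.List using (List; []; _∷_; _++_; _∷ʳ_; reverse; concat; map; length; filterᵇ; replicate; upTo; applyUpTo)
open import Data.List.Properties using (unfold-reverse; reverse-involutive; length-reverse; map-upTo)
import Data.List.Properties as Listₚ
open import Data.Maybe using (Maybe; just; nothing; maybe′)
import Data.Maybe.Properties as Maybeₚ
open import Data.Unit using (tt)
open import Data.Product using (_×_; _,_; proj₁; proj₂)
open import Data.Empty using (⊥-elim)
open import Relation.Nullary using (yes; no; ¬_)
open import Relation.Nullary.Decidable using (dec-true; dec-false)
open import Relation.Binary.PropositionalEquality

∧-swap : ∀ x y z → x ∧ (y ∧ z) ≡ y ∧ (x ∧ z)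
∧-swap true y z = refl
∧-swap false true z = refl
∧-swap false false z = refl

∧-trueʳ : ∀ x y → x ∧ y ≡ true → y ≡ true
∧-trueʳ true y e = e

⟦_⟧ : Bool → ℕ
⟦ true ⟧ = 1
⟦ false ⟧ = 0

count : {A : Set} → (A → Bool) → List A → ℕ
count P [] = 0
count P (x ∷ xs) = ⟦ P x ⟧ + count P xs

module _ {A : Set} where

  length-filter : (P : A → Bool) (xs : List A) → length (filterᵇ P xs) ≡ count P xs
  length-filter P [] = refl
  length-filter P (x ∷ xs) with P x
  ... | true = cong suc (length-filter P xs)
  ... | false = length-filter P xs

  filter-filter : (P Q : A → Bool) (xs : List A) →
    filterᵇ Q (filterᵇ P xs) ≡ filterᵇ (λ x → P x ∧ Q x) xs
  filter-filter P Q [] = refl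
  filter-filter P Q (x ∷ xs) with P x
  ... | false = filter-filter P Q xs
  ... | true with Q x
  ...   | true = cong (x ∷_) (filter-filter P Q xs)
  ...   | false = filter-filter P Q xs

  count-cong : {P Q : A → Bool} → (∀ x → P x ≡ Q x) → ∀ xs → count P xs ≡ count Q xs
  count-cong e [] = refl
  count-cong e (x ∷ xs) = cong₂ _+_ (cong ⟦_⟧ (e x)) (count-cong e xs)

  count-++ : ∀ (P : A → Bool) (xs ys : List A) → count P (xs ++ ys) ≡ count P xs + count P ys
  count-++ P [] ys = refl
  count-++ P (x ∷ xs) ys =
    trans (cong (⟦ P x ⟧ +_) (count-++ P xs ys)) (sym (+-assoc ⟦ P x ⟧ _ _))

  count-none : ∀ (xs : List A) → count (λ _ → false) xs ≡ 0
  count-none [] = refl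
  count-none (x ∷ xs) = count-none xs

  count-guard : ∀ c (P : A → Bool) (xs : List A) → count (λ x → c ∧ P x) xs ≡ (if c then count P xs else 0)
  count-guard true P xs = refl
  count-guard false P xs = count-none xs

Σstep : (Step → ℕ) → ℕ
Σstep f = f E + (f N + f D)

Σstep-cong : {f g : Step → ℕ} → (∀ s → f s ≡ g s) → Σstep f ≡ Σstep g
Σstep-cong e = cong₂ _+_ (e E) (cong₂ _+_ (e N) (e D))

Σstep-+ : (f g : Step → ℕ) → Σstep f + Σstep g ≡ Σstep (λ s → f s + g s)
Σstep-+ f g = interchange (f E) (f N) (f D) (g E) (g N) (g D)
  where
    interchange : ∀ a b c x y z → (a + (b + c)) + (x + (y + z)) ≡ (a + x) + ((b + y) + (c + z))
    interchange = solve-∀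

Σstep-swap : (h : Step → Step → ℕ) → Σstep (λ t → Σstep (λ s → h s t)) ≡ Σstep (λ s → Σstep (λ t → h s t))
Σstep-swap h = transpose (h E E) (h N E) (h D E) (h E N) (h N N) (h D N) (h E D) (h N D) (h D D)
  where
    transpose : ∀ a b c d e f g i j →
      (a + (b + c)) + ((d + (e + f)) + (g + (i + j))) ≡ (a + (d + g)) + ((b + (e + i)) + (c + (f + j)))
    transpose = solve-∀

-- Every word of length k+1 is s ∷ w
-- for a unique step s and word w of length k, and also w ∷ʳ t for a unique t;
-- hence counts are invariant under reversing the words.

count-words-first : ∀ (P : Path → Bool) k → count P (words (suc k)) ≡ Σstep (λ s → count (λ w → P (s ∷ w)) (words k))
count-words-first P k = go (words k)
  where
    go : ∀ ws → count P (concat (map (λ w → (E ∷ w) ∷ (N ∷ w) ∷ (D ∷ w) ∷ []) ws)) ≡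
                Σstep (λ s → count (λ w → P (s ∷ w)) ws)
    go [] = refl
    go (w ∷ ws) = begin
        ⟦ P (E ∷ w) ⟧ + (⟦ P (N ∷ w) ⟧ + (⟦ P (D ∷ w) ⟧ + rest))
      ≡⟨ regroup ⟦ P (E ∷ w) ⟧ ⟦ P (N ∷ w) ⟧ ⟦ P (D ∷ w) ⟧ rest ⟩
        Σstep (λ s → ⟦ P (s ∷ w) ⟧) + rest
      ≡⟨ cong (Σstep (λ s → ⟦ P (s ∷ w) ⟧) +_) (go ws) ⟩
        Σstep (λ s → ⟦ P (s ∷ w) ⟧) + Σstep (λ s → count (λ v → P (s ∷ v)) ws)
      ≡⟨ Σstep-+ (λ s → ⟦ P (s ∷ w) ⟧) (λ s → count (λ v → P (s ∷ v)) ws) ⟩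
        Σstep (λ s → count (λ v → P (s ∷ v)) (w ∷ ws))
      ∎
      where
        open ≡-Reasoning
        rest = count P (concat (map (λ w → (E ∷ w) ∷ (N ∷ w) ∷ (D ∷ w) ∷ []) ws))
        regroup : ∀ a b c r → a + (b + (c + r)) ≡ (a + (b + c)) + r
        regroup = solve-∀

count-words-last : ∀ k (P : Path → Bool) → Σstep (λ s → count (λ w → P (s ∷ w)) (words k)) ≡
                           Σstep (λ t → count (λ w → P (w ∷ʳ t)) (words k))
count-words-last zero P = refl
count-words-last (suc k) P = begin
    Σstep (λ s → count (λ w → P (s ∷ w)) (words (suc k)))
  ≡⟨ Σstep-cong (λ s → count-words-first (λ w → P (s ∷ w)) k) ⟩
    Σstep (λ s → Σstep (λ r → count (λ w → P (s ∷ r ∷ w)) (words k)))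
  ≡⟨ Σstep-cong (λ s → count-words-last k (λ w → P (s ∷ w))) ⟩
    Σstep (λ s → Σstep (λ t → count (λ w → P (s ∷ (w ∷ʳ t))) (words k)))
  ≡⟨ sym (Σstep-swap (λ s t → count (λ w → P (s ∷ (w ∷ʳ t))) (words k))) ⟩
    Σstep (λ t → Σstep (λ s → count (λ w → P (s ∷ (w ∷ʳ t))) (words k)))
  ≡⟨ Σstep-cong (λ t → sym (count-words-first (λ v → P (v ∷ʳ t)) k)) ⟩
    Σstep (λ t → count (λ w → P (w ∷ʳ t)) (words (suc k)))
  ∎ where open ≡-Reasoning

count-words-reverse : ∀ k (P : Path → Bool) → count P (words k) ≡ count (λ w → P (reverse w)) (words k)
count-words-reverse zero P = refl
count-words-reverse (suc k) P = begin
    count P (words (suc k))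
  ≡⟨ count-words-first P k ⟩
    Σstep (λ s → count (λ w → P (s ∷ w)) (words k))
  ≡⟨ count-words-last k P ⟩
    Σstep (λ t → count (λ w → P (w ∷ʳ t)) (words k))
  ≡⟨ Σstep-cong (λ t → count-words-reverse k (λ w → P (w ∷ʳ t))) ⟩
    Σstep (λ t → count (λ w → P (reverse w ∷ʳ t)) (words k))
  ≡⟨ Σstep-cong (λ t → count-cong (λ w → cong P (sym (unfold-reverse t w))) (words k)) ⟩
    Σstep (λ t → count (λ w → P (reverse (t ∷ w))) (words k))
  ≡⟨ sym (count-words-first (λ w → P (reverse w)) k) ⟩
    count (λ w → P (reverse w)) (words (suc k))
  ∎ where open ≡-Reasoning

wordsOf : List ℕ → List Path
wordsOf ks = concat (map words ks)

count-wordsOf-reverse : ∀ (P : Path → Bool) ks → count P (wordsOf ks) ≡ count (λ w → P (reverse w)) (wordsOf ks)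
count-wordsOf-reverse P [] = refl
count-wordsOf-reverse P (k ∷ ks) = begin
    count P (words k ++ wordsOf ks)
  ≡⟨ count-++ P (words k) (wordsOf ks) ⟩
    count P (words k) + count P (wordsOf ks)
  ≡⟨ cong₂ _+_ (count-words-reverse k P) (count-wordsOf-reverse P ks) ⟩
    count (λ w → P (reverse w)) (words k) + count (λ w → P (reverse w)) (wordsOf ks)
  ≡⟨ sym (count-++ (λ w → P (reverse w)) (words k) (wordsOf ks)) ⟩
    count (λ w → P (reverse w)) (words k ++ wordsOf ks)
  ∎ where open ≡-Reasoning

count-wordsOf-first : ∀ (P : Path → Bool) ks →
  count P (wordsOf (map suc ks)) ≡ Σstep (λ s → count (λ w → P (s ∷ w)) (wordsOf ks))
count-wordsOf-first P [] = refl
count-wordsOf-first P (k ∷ ks) = begin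
    count P (words (suc k) ++ wordsOf (map suc ks))
  ≡⟨ count-++ P (words (suc k)) (wordsOf (map suc ks)) ⟩
    count P (words (suc k)) + count P (wordsOf (map suc ks))
  ≡⟨ cong₂ _+_ (count-words-first P k) (count-wordsOf-first P ks) ⟩
    Σstep (λ s → count (λ w → P (s ∷ w)) (words k)) + Σstep (λ s → count (λ w → P (s ∷ w)) (wordsOf ks))
  ≡⟨ Σstep-+ (λ s → count (λ w → P (s ∷ w)) (words k)) (λ s → count (λ w → P (s ∷ w)) (wordsOf ks)) ⟩
    Σstep (λ s → count (λ w → P (s ∷ w)) (words k) + count (λ w → P (s ∷ w)) (wordsOf ks))
  ≡⟨ Σstep-cong (λ s → sym (count-++ (λ w → P (s ∷ w)) (words k) (wordsOf ks))) ⟩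
    Σstep (λ s → count (λ w → P (s ∷ w)) (wordsOf (k ∷ ks)))
  ∎ where open ≡-Reasoning

count-wordsUpTo-first : ∀ (P : Path → Bool) L →
  count P (wordsUpTo (suc L)) ≡ ⟦ P [] ⟧ + Σstep (λ s → count (λ w → P (s ∷ w)) (wordsUpTo L))
count-wordsUpTo-first P L = cong (⟦ P [] ⟧ +_) (begin
    count P (wordsOf (applyUpTo suc (suc L)))
  ≡⟨ cong (λ ks → count P (wordsOf ks)) (sym (map-upTo suc (suc L))) ⟩
    count P (wordsOf (map suc (upTo (suc L))))
  ≡⟨ count-wordsOf-first P (upTo (suc L)) ⟩
    Σstep (λ s → count (λ w → P (s ∷ w)) (wordsUpTo L))
  ∎)
  where open ≡-Reasoning

-- The block decomposition, on reversed paths.  `unitBlocked rs` says that,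
-- reading the path backwards, every E is immediately followed by N: the path is
-- made of the unit blocks D and NE and of free N steps.

unitBlocked : List Step → Bool
unitBlocked [] = true
unitBlocked (E ∷ N ∷ rs) = unitBlocked rs
unitBlocked (E ∷ _) = false
unitBlocked (N ∷ rs) = unitBlocked rs
unitBlocked (D ∷ rs) = unitBlocked rs

width : List Step → ℕ
width [] = 0
width (E ∷ rs) = suc (width rs)
width (N ∷ rs) = width rs
width (D ∷ rs) = suc (width rs)

scan-size-grows : ∀ h j rs {j' rest} → scan h j rs ≡ just (j' , rest) → j ≤ j'
scan-size-grows h j (E ∷ rs) e = ≤-trans (n≤1+n j) (scan-size-grows (suc h) (suc j) rs e)
scan-size-grows h j (D ∷ rs) e = ≤-trans (n≤1+n j) (scan-size-grows h (suc j) rs e)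
scan-size-grows zero j (N ∷ rs) refl = ≤-refl
scan-size-grows (suc h) j (N ∷ rs) e = scan-size-grows h j rs e

scan-unit : ∀ rs rest → scan 0 1 rs ≡ just (1 , rest) → rs ≡ N ∷ rest
scan-unit (N ∷ rs) rest refl = refl
scan-unit (E ∷ rs) rest e with scan-size-grows 1 2 rs e
... | s≤s ()
scan-unit (D ∷ rs) rest e with scan-size-grows 0 2 rs e
... | s≤s ()

blocks-of-unitBlocked : ∀ k rs → length rs ≤ k → unitBlocked rs ≡ true →
  blocksFuel k rs ≡ just (replicate (width rs) 1)
blocks-of-unitBlocked k [] _ _ = refl
blocks-of-unitBlocked (suc k) (D ∷ rs) (s≤s le) u rewrite blocks-of-unitBlocked k rs le u = refl
blocks-of-unitBlocked (suc k) (N ∷ rs) (s≤s le) u = blocks-of-unitBlocked k rs le u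
blocks-of-unitBlocked (suc k) (E ∷ N ∷ rs) (s≤s le) u
  rewrite blocks-of-unitBlocked k rs (≤-trans (n≤1+n _) le) u = refl

unitBlocked-of-blocks : ∀ k rs m → blocksFuel k rs ≡ just (replicate m 1) → unitBlocked rs ≡ true
unitBlocked-of-blocks k [] m e = refl
unitBlocked-of-blocks (suc k) (D ∷ rs) m e with blocksFuel k rs in eb
unitBlocked-of-blocks (suc k) (D ∷ rs) (suc m) refl | just .(replicate m 1) =
  unitBlocked-of-blocks k rs m eb
unitBlocked-of-blocks (suc k) (N ∷ rs) m e = unitBlocked-of-blocks k rs m e
unitBlocked-of-blocks (suc k) (E ∷ rs) m e with scan 0 1 rs in es
... | just (j , rest) with blocksFuel k rest in eb
unitBlocked-of-blocks (suc k) (E ∷ rs) (suc m) refl | just (.1 , rest) | just .(replicate m 1)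
  rewrite scan-unit rs rest es = unitBlocked-of-blocks k rest m eb

nUnitBlocks-reverse : ∀ n rs → width rs ≡ n → nUnitBlocks n (reverse rs) ≡ unitBlocked rs
nUnitBlocks-reverse n rs w≡n with unitBlocked rs in u
... | true = dec-true (Maybeₚ.≡-dec (Listₚ.≡-dec _≟_) _ _) (begin
      blockSizes (reverse rs)
    ≡⟨ cong₂ blocksFuel (length-reverse rs) (reverse-involutive rs) ⟩
      blocksFuel (length rs) rs
    ≡⟨ blocks-of-unitBlocked (length rs) rs ≤-refl u ⟩
      just (replicate (width rs) 1)
    ≡⟨ cong (λ m → just (replicate m 1)) w≡n ⟩
      just (replicate n 1)
    ∎)
  where open ≡-Reasoning
... | false = dec-false (Maybeₚ.≡-dec (Listₚ.≡-dec _≟_) _ _) λ e → false≢true (trans (sym u)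
    (unitBlocked-of-blocks (length rs) rs n
      (trans (sym (cong₂ blocksFuel (length-reverse rs) (reverse-involutive rs))) e)))
  where
    false≢true : false ≢ true
    false≢true ()

absorption : ∀ m k → suc k * (suc m C suc k) ≡ suc m * (m C k)
absorption zero zero = refl
absorption zero (suc k) = trans (cong (suc (suc k) *_) (k>n⇒nCk≡0 {1} {suc (suc k)} (s≤s (s≤s z≤n)))) (*-zeroʳ (suc (suc k)))
absorption (suc m) zero = trans (+-identityʳ _) (trans (nC1≡n (suc (suc m))) (sym (*-identityʳ _)))
absorption (suc m) (suc k) = begin
    suc (suc k) * (suc (suc m) C suc (suc k))
  ≡⟨ cong (suc (suc k) *_) (sym (nCk+nC[k+1]≡[n+1]C[k+1] (suc m) (suc k))) ⟩
    suc (suc k) * (A + A′)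
  ≡⟨ *-distribˡ-+ (suc (suc k)) A A′ ⟩
    (A + suc k * A) + suc (suc k) * A′
  ≡⟨ cong₂ (λ x y → (A + x) + y) (absorption m k) (absorption m (suc k)) ⟩
    (A + suc m * (m C k)) + suc m * (m C suc k)
  ≡⟨ +-assoc A _ _ ⟩
    A + (suc m * (m C k) + suc m * (m C suc k))
  ≡⟨ cong (A +_) (sym (*-distribˡ-+ (suc m) (m C k) (m C suc k))) ⟩
    A + suc m * (m C k + m C suc k)
  ≡⟨ cong (λ x → A + suc m * x) (nCk+nC[k+1]≡[n+1]C[k+1] m k) ⟩
    A + suc m * A
  ∎ where
    open ≡-Reasoning
    A = suc m C suc k
    A′ = suc m C suc (suc k)

binomial-ratio : ∀ k d → suc k * ((k + d) C suc k) ≡ d * ((k + d) C k)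
binomial-ratio k d = +-cancelˡ-≡ (suc k * (m C k)) _ _ (begin
    suc k * (m C k) + suc k * (m C suc k)
  ≡⟨ sym (*-distribˡ-+ (suc k) (m C k) (m C suc k)) ⟩
    suc k * (m C k + m C suc k)
  ≡⟨ cong (suc k *_) (nCk+nC[k+1]≡[n+1]C[k+1] m k) ⟩
    suc k * (suc m C suc k)
  ≡⟨ absorption m k ⟩
    suc m * (m C k)
  ≡⟨ *-distribʳ-+ (m C k) (suc k) d ⟩
    suc k * (m C k) + d * (m C k)
  ∎)
  where
    open ≡-Reasoning
    m = k + d

-- The arithmetic of the induction step of the ballot formula below: at height
-- B = α(a+1) + s, the values s·2^(a+1)·C(B, a+1) and (α+s)·2^a·C(B, a) on the
-- previous row combine, by Pascal's rule and absorption, to (s+1)·2^(a+1)·C(B+1, a+1).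
ballot-step : ∀ α a s B P₁ P₂ → α * suc a + s ≡ B →
  B * P₁ ≡ s * (2 ^ suc a * (B C suc a)) →
  B * P₂ ≡ (α + s) * (2 ^ a * (B C a)) →
  B * (suc B * (P₁ + 2 * P₂)) ≡ B * (suc s * (2 ^ suc a * (suc B C suc a)))
ballot-step α a s B P₁ P₂ refl h₁ h₂ = begin
    B * (suc B * (P₁ + 2 * P₂))
  ≡⟨ expand B P₁ P₂ ⟩
    suc B * (B * P₁) + 2 * (suc B * (B * P₂))
  ≡⟨ cong₂ (λ u v → suc B * u + 2 * (suc B * v)) h₁ h₂ ⟩
    suc B * (s * (2 * p * Z)) + 2 * (suc B * ((α + s) * (p * Y)))
  ≡⟨ collect B s α p Y Z ⟩
    2 * p * (s * suc B * (Y + Z) + α * (suc B * Y))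
  ≡⟨ cong₂ (λ u v → 2 * p * (s * suc B * u + α * v))
           (nCk+nC[k+1]≡[n+1]C[k+1] B a) (sym (absorption B a)) ⟩
    2 * p * (s * suc B * X + α * (suc a * X))
  ≡⟨ conclude α a s p X ⟩
    B * (suc s * (2 * p * X))
  ∎ where
    open ≡-Reasoning
    p = 2 ^ a
    X = suc B C suc a
    Y = B C a
    Z = B C suc a
    expand : ∀ B P₁ P₂ → B * (suc B * (P₁ + 2 * P₂)) ≡ suc B * (B * P₁) + 2 * (suc B * (B * P₂))
    expand = solve-∀
    collect : ∀ B s α p Y Z → suc B * (s * (2 * p * Z)) + 2 * (suc B * ((α + s) * (p * Y))) ≡
                              2 * p * (s * suc B * (Y + Z) + α * (suc B * Y))
    collect = solve-∀
    conclude : ∀ α a s p X → 2 * p * (s * suc (α * suc a + s) * X + α * (suc a * X)) ≡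
                             (α * suc a + s) * (suc s * (2 * p * X))
    conclude = solve-∀

module Reversed (α : ℕ) where

  Point : Set
  Point = ℕ × ℕ

  above : Point → Bool
  above (x , y) = α * x ≤ᵇ y

  _≡ᵖ_ : Point → Point → Bool
  (x , y) ≡ᵖ (a , b) = (x ≡ᵇ a) ∧ (y ≡ᵇ b)

  origin : Step → Point → Maybe Point
  origin E (suc a , b) = just (a , b)
  origin N (a , suc b) = just (a , b)
  origin D (suc a , suc b) = just (a , b)
  origin _ _ = nothing

  stepBack : Step → Point → (Point → Bool) → Bool
  stepBack s t k = maybe′ k false (origin s t)

  stepBack-cong : ∀ s t {k l : Point → Bool} → (∀ t′ → k t′ ≡ l t′) → stepBack s t k ≡ stepBack s t l
  stepBack-cong s t e with origin s t
  ... | just t′ = e t′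
  ... | nothing = refl

  ∧-stepBack : ∀ c s t (k : Point → Bool) → c ∧ stepBack s t k ≡ stepBack s t (λ t′ → c ∧ k t′)
  ∧-stepBack c s t k with origin s t
  ... | just t′ = refl
  ... | nothing = ∧-zeroʳ c

  stepBack-∧ : ∀ c s t (k : Point → Bool) → stepBack s t k ∧ c ≡ stepBack s t (λ t′ → k t′ ∧ c)
  stepBack-∧ c s t k with origin s t
  ... | just t′ = refl
  ... | nothing = refl

  ∧-guarded : ∀ c s t (k : Point → Bool) →
    c ∧ (above t ∧ stepBack s t k) ≡ above t ∧ stepBack s t (λ t′ → c ∧ k t′)
  ∧-guarded c s t k = trans (∧-swap c (above t) _) (cong (above t ∧_) (∧-stepBack c s t k))

  guarded-∧ : ∀ c s t (k : Point → Bool) →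
    (above t ∧ stepBack s t k) ∧ c ≡ above t ∧ stepBack s t (λ t′ → k t′ ∧ c)
  guarded-∧ c s t k = trans (∧-assoc (above t) _ c) (cong (above t ∧_) (stepBack-∧ c s t k))

  at-target : ∀ (F : Point → Bool) p t → F p ∧ (p ≡ᵖ t) ≡ F t ∧ (p ≡ᵖ t)
  at-target F (x , y) (a , b) with x ≡ᵇ a in ex | y ≡ᵇ b in ey
  ... | false | _ = trans (∧-zeroʳ (F (x , y))) (sym (∧-zeroʳ (F (a , b))))
  ... | true | false = trans (∧-zeroʳ (F (x , y))) (sym (∧-zeroʳ (F (a , b))))
  ... | true | true rewrite ≡ᵇ⇒≡ x a (subst T (sym ex) tt) | ≡ᵇ⇒≡ y b (subst T (sym ey) tt) = refl

  move-≡ᵖ : ∀ s q t → (move s q ≡ᵖ t) ≡ stepBack s t (q ≡ᵖ_)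
  move-≡ᵖ E (x , y) (zero , b) = refl
  move-≡ᵖ E (x , y) (suc a , b) = refl
  move-≡ᵖ N (x , y) (a , zero) = ∧-zeroʳ (x ≡ᵇ a)
  move-≡ᵖ N (x , y) (a , suc b) = refl
  move-≡ᵖ D (x , y) (zero , b) = refl
  move-≡ᵖ D (x , y) (suc a , zero) = ∧-zeroʳ (x ≡ᵇ a)
  move-≡ᵖ D (x , y) (suc a , suc b) = refl

  lastStep : ∀ s t xs q → aboveAndEndsFrom α t q (xs ∷ʳ s) ≡
    above t ∧ stepBack s t (λ t′ → aboveAndEndsFrom α t′ q xs)
  lastStep s t [] q = begin
      above q ∧ aboveAndEndsFrom α t (move s q) []
    ≡⟨ cong (above q ∧_) (at-target above (move s q) t) ⟩
      above q ∧ (above t ∧ (move s q ≡ᵖ t))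
    ≡⟨ cong (λ z → above q ∧ (above t ∧ z)) (move-≡ᵖ s q t) ⟩
      above q ∧ (above t ∧ stepBack s t (q ≡ᵖ_))
    ≡⟨ ∧-guarded (above q) s t (q ≡ᵖ_) ⟩
      above t ∧ stepBack s t (λ t′ → above q ∧ (q ≡ᵖ t′))
    ∎ where open ≡-Reasoning
  lastStep s t (z ∷ xs) q = trans (cong (above q ∧_) (lastStep s t xs (move z q)))
    (∧-guarded (above q) s t (λ t′ → aboveAndEndsFrom α t′ (move z q) xs))

  endsAt : Point → List Step → Bool
  endsAt t [] = aboveAndEndsFrom α t (0 , 0) []
  endsAt t (s ∷ rs) = above t ∧ stepBack s t (λ t′ → endsAt t′ rs)

  endsAt-reverse : ∀ rs t → aboveAndEndsFrom α t (0 , 0) (reverse rs) ≡ endsAt t rs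
  endsAt-reverse [] t = refl
  endsAt-reverse (s ∷ rs) t = begin
      aboveAndEndsFrom α t (0 , 0) (reverse (s ∷ rs))
    ≡⟨ cong (aboveAndEndsFrom α t (0 , 0)) (unfold-reverse s rs) ⟩
      aboveAndEndsFrom α t (0 , 0) (reverse rs ∷ʳ s)
    ≡⟨ lastStep s t (reverse rs) (0 , 0) ⟩
      above t ∧ stepBack s t (λ t′ → aboveAndEndsFrom α t′ (0 , 0) (reverse rs))
    ≡⟨ cong (above t ∧_) (stepBack-cong s t (endsAt-reverse rs)) ⟩
      endsAt t (s ∷ rs)
    ∎ where open ≡-Reasoning

  width-endsAt : ∀ rs a b → endsAt (a , b) rs ≡ true → width rs ≡ a
  width-stepBack : ∀ s a b rs → stepBack s (a , b) (λ t′ → endsAt t′ rs) ≡ true → width (s ∷ rs) ≡ a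
  width-endsAt [] zero b e = refl
  width-endsAt [] (suc a) b e with ∧-trueʳ (α * 0 ≤ᵇ 0) false e
  ... | ()
  width-endsAt (s ∷ rs) a b e = width-stepBack s a b rs (∧-trueʳ (above (a , b)) _ e)
  width-stepBack E (suc a) b rs e = cong suc (width-endsAt rs a b e)
  width-stepBack N a (suc b) rs e = width-endsAt rs a b e
  width-stepBack D (suc a) (suc b) rs e = cong suc (width-endsAt rs a b e)
  width-stepBack E zero b rs ()
  width-stepBack N a zero rs ()
  width-stepBack D zero b rs ()
  width-stepBack D (suc a) zero rs ()

  -- The definition follows the
  -- last block, which makes the recursion for the number of such paths visible.
  good : Point → List Step → Bool
  good t [] = endsAt t []
  good t (N ∷ rs) = above t ∧ stepBack N t (λ t′ → good t′ rs)
  good t (D ∷ rs) = above t ∧ stepBack D t (λ t′ → good t′ rs)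
  good t (E ∷ N ∷ rs) = above t ∧ stepBack E t (λ t′ → above t′ ∧ stepBack N t′ (λ t″ → good t″ rs))
  good t (E ∷ _) = false

  good-split : ∀ rs t → endsAt t rs ∧ unitBlocked rs ≡ good t rs
  good-split [] t = ∧-identityʳ (endsAt t [])
  good-split (N ∷ rs) t = trans (guarded-∧ (unitBlocked rs) N t _)
    (cong (above t ∧_) (stepBack-cong N t (good-split rs)))
  good-split (D ∷ rs) t = trans (guarded-∧ (unitBlocked rs) D t _)
    (cong (above t ∧_) (stepBack-cong D t (good-split rs)))
  good-split (E ∷ N ∷ rs) t = trans (guarded-∧ (unitBlocked rs) E t _)
    (cong (above t ∧_) (stepBack-cong E t λ t′ → trans (guarded-∧ (unitBlocked rs) N t′ _)
      (cong (above t′ ∧_) (stepBack-cong N t′ (good-split rs)))))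
  good-split (E ∷ []) t = ∧-zeroʳ (endsAt t (E ∷ []))
  good-split (E ∷ E ∷ rs) t = ∧-zeroʳ (endsAt t (E ∷ E ∷ rs))
  good-split (E ∷ D ∷ rs) t = ∧-zeroʳ (endsAt t (E ∷ D ∷ rs))

  counted-reverse : ∀ n rs → inS α n (reverse rs) ∧ nUnitBlocks n (reverse rs) ≡ good (n , α * n) rs
  counted-reverse n rs = begin
      inS α n (reverse rs) ∧ nUnitBlocks n (reverse rs)
    ≡⟨ cong (_∧ nUnitBlocks n (reverse rs)) (endsAt-reverse rs (n , α * n)) ⟩
      endsAt (n , α * n) rs ∧ nUnitBlocks n (reverse rs)
    ≡⟨ unit-blocks ⟩
      endsAt (n , α * n) rs ∧ unitBlocked rs
    ≡⟨ good-split rs (n , α * n) ⟩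
      good (n , α * n) rs
    ∎ where
      open ≡-Reasoning
      unit-blocks : endsAt (n , α * n) rs ∧ nUnitBlocks n (reverse rs) ≡ endsAt (n , α * n) rs ∧ unitBlocked rs
      unit-blocks with endsAt (n , α * n) rs in e
      ... | true = nUnitBlocks-reverse n rs (width-endsAt rs n (α * n) e)
      ... | false = refl

  paths : ℕ → ℕ → ℕ
  viaNE viaN viaD : ℕ → ℕ → ℕ
  paths a b = ⟦ good (a , b) [] ⟧ + (viaNE a b + (viaN a b + viaD a b))
  viaNE (suc a) (suc b) = if above (suc a , suc b) ∧ above (a , suc b) then paths a b else 0
  viaNE _ _ = 0
  viaN a (suc b) = if above (a , suc b) then paths a b else 0
  viaN a zero = 0
  viaD (suc a) (suc b) = if above (suc a , suc b) then paths a b else 0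
  viaD _ _ = 0

  count-good : ∀ L a b → a + b ≤ L → count (good (a , b)) (wordsUpTo L) ≡ paths a b
  count-viaNE : ∀ L a b → a + b ≤ suc L → count (λ w → good (a , b) (E ∷ w)) (wordsUpTo L) ≡ viaNE a b
  count-viaN : ∀ L a b → a + b ≤ suc L → count (λ w → good (a , b) (N ∷ w)) (wordsUpTo L) ≡ viaN a b
  count-viaD : ∀ L a b → a + b ≤ suc L → count (λ w → good (a , b) (D ∷ w)) (wordsUpTo L) ≡ viaD a b

  count-good zero zero zero _ = refl
  count-good (suc L) a b le = trans (count-wordsUpTo-first (good (a , b)) L)
    (cong (⟦ good (a , b) [] ⟧ +_)
      (cong₂ _+_ (count-viaNE L a b le) (cong₂ _+_ (count-viaN L a b le) (count-viaD L a b le))))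

  count-viaN L a zero _ rewrite ∧-zeroʳ (above (a , zero)) = count-none (wordsUpTo L)
  count-viaN L a (suc b) le = trans (count-guard (above (a , suc b)) (good (a , b)) (wordsUpTo L))
    (cong (λ z → if above (a , suc b) then z else 0)
      (count-good L a b (≤-pred (subst (_≤ suc L) (+-suc a b) le))))

  count-viaD L zero b _ rewrite ∧-zeroʳ (above (zero , b)) = count-none (wordsUpTo L)
  count-viaD L (suc a) zero _ rewrite ∧-zeroʳ (above (suc a , zero)) = count-none (wordsUpTo L)
  count-viaD L (suc a) (suc b) (s≤s le) =
    trans (count-guard (above (suc a , suc b)) (good (a , b)) (wordsUpTo L))
      (cong (λ z → if above (suc a , suc b) then z else 0)
        (count-good L a b (≤-trans (n≤1+n _) (subst (_≤ L) (+-suc a b) le))))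

  count-viaNE zero zero b _ = refl
  count-viaNE zero (suc a) zero _ = refl
  count-viaNE zero (suc a) (suc b) (s≤s le) with subst (_≤ 0) (+-suc a b) le
  ... | ()
  count-viaNE (suc L) a b le = begin
      count (λ w → good (a , b) (E ∷ w)) (wordsUpTo (suc L))
    ≡⟨ count-wordsUpTo-first (λ w → good (a , b) (E ∷ w)) L ⟩
      count (λ _ → false) (wordsUpTo L) + (viaNE-words + count (λ _ → false) (wordsUpTo L))
    ≡⟨ cong₂ (λ u v → u + (viaNE-words + v)) (count-none (wordsUpTo L)) (count-none (wordsUpTo L)) ⟩
      viaNE-words + 0
    ≡⟨ +-identityʳ viaNE-words ⟩
      viaNE-words
    ≡⟨ count-NE a b le ⟩
      viaNE a b
    ∎ where
      open ≡-Reasoning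
      viaNE-words = count (λ w → good (a , b) (E ∷ N ∷ w)) (wordsUpTo L)
      count-NE : ∀ a b → a + b ≤ suc (suc L) → count (λ w → good (a , b) (E ∷ N ∷ w)) (wordsUpTo L) ≡ viaNE a b
      count-NE zero b _ rewrite ∧-zeroʳ (above (zero , b)) = count-none (wordsUpTo L)
      count-NE (suc a) zero _ rewrite ∧-zeroʳ (above (a , zero)) | ∧-zeroʳ (above (suc a , zero)) =
        count-none (wordsUpTo L)
      count-NE (suc a) (suc b) (s≤s le′) = begin
          count (λ w → above (suc a , suc b) ∧ (above (a , suc b) ∧ good (a , b) w)) (wordsUpTo L)
        ≡⟨ count-cong (λ w → sym (∧-assoc (above (suc a , suc b)) (above (a , suc b)) (good (a , b) w))) (wordsUpTo L) ⟩
          count (λ w → (above (suc a , suc b) ∧ above (a , suc b)) ∧ good (a , b) w) (wordsUpTo L)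
        ≡⟨ count-guard (above (suc a , suc b) ∧ above (a , suc b)) (good (a , b)) (wordsUpTo L) ⟩
          (if above (suc a , suc b) ∧ above (a , suc b) then count (good (a , b)) (wordsUpTo L) else 0)
        ≡⟨ cong (λ z → if above (suc a , suc b) ∧ above (a , suc b) then z else 0)
             (count-good L a b (≤-pred (subst (_≤ suc L) (+-suc a b) le′))) ⟩
          viaNE (suc a) (suc b)
        ∎

  above-true : ∀ {a b} → α * a ≤ b → above (a , b) ≡ true
  above-true {a} {b} = dec-true (α * a ≤? b)

  above-false : ∀ {a b} → ¬ α * a ≤ b → above (a , b) ≡ false
  above-false {a} {b} = dec-false (α * a ≤? b)

  axis-above : ∀ b → α * 0 ≤ b
  axis-above b = subst (_≤ b) (sym (*-zeroʳ α)) z≤n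

  empty-off-axis : ∀ a b → ⟦ good (suc a , b) [] ⟧ ≡ 0
  empty-off-axis a b = cong ⟦_⟧ (∧-zeroʳ (α * 0 ≤ᵇ 0))

  empty-above-origin : ∀ a b → ⟦ good (a , suc b) [] ⟧ ≡ 0
  empty-above-origin a b = cong ⟦_⟧ (trans (cong ((α * 0 ≤ᵇ 0) ∧_) (∧-zeroʳ (0 ≡ᵇ a))) (∧-zeroʳ (α * 0 ≤ᵇ 0)))

  paths-axis : ∀ b → paths 0 b ≡ 1
  paths-axis zero rewrite *-zeroʳ α = refl
  paths-axis (suc b) = begin
      ⟦ good (0 , suc b) [] ⟧ + (0 + ((if above (0 , suc b) then paths 0 b else 0) + 0))
    ≡⟨ cong₂ (λ u c → u + (0 + ((if c then paths 0 b else 0) + 0)))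
             (empty-above-origin 0 b) (above-true (axis-above (suc b))) ⟩
      paths 0 b + 0
    ≡⟨ +-identityʳ (paths 0 b) ⟩
      paths 0 b
    ≡⟨ paths-axis b ⟩
      1
    ∎ where open ≡-Reasoning

  paths-floor : ∀ a → paths (suc a) 0 ≡ 0
  paths-floor a = cong (_+ 0) (empty-off-axis a 0)

  paths-below : ∀ a b → ¬ α * a ≤ suc b → paths a (suc b) ≡ 0
  paths-below zero b nle = ⊥-elim (nle (axis-above (suc b)))
  paths-below (suc a) b nle =
    cong₂ (λ u c → u + ((if c ∧ above (a , suc b) then paths a b else 0) +
                         ((if c then paths (suc a) b else 0) + (if c then paths a b else 0))))
          (empty-off-axis a (suc b)) (above-false nle)

  paths-step : ∀ a b → α * suc a ≤ suc b → paths (suc a) (suc b) ≡ paths (suc a) b + 2 * paths a b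
  paths-step a b le = begin
      ⟦ good (suc a , suc b) [] ⟧ + last-blocks (above (suc a , suc b)) (above (a , suc b))
    ≡⟨ cong₂ (λ u c → u + last-blocks c (above (a , suc b))) (empty-off-axis a (suc b)) (above-true le) ⟩
      last-blocks true (above (a , suc b))
    ≡⟨ cong (last-blocks true) (above-true (≤-trans (*-monoʳ-≤ α (n≤1+n a)) le)) ⟩
      paths a b + (paths (suc a) b + paths a b)
    ≡⟨ arrange (paths a b) (paths (suc a) b) ⟩
      paths (suc a) b + 2 * paths a b
    ∎ where
      open ≡-Reasoning
      last-blocks : Bool → Bool → ℕ
      last-blocks c c′ = (if c ∧ c′ then paths a b else 0) + ((if c then paths (suc a) b else 0) + (if c then paths a b else 0))
      arrange : ∀ p q → p + (q + p) ≡ q + 2 * p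
      arrange = solve-∀

  countUnitBlocks≡paths : ∀ n → countUnitBlocks α n ≡ paths n (α * n)
  countUnitBlocks≡paths n = begin
      length (filterᵇ (nUnitBlocks n) (filterᵇ (inS α n) W))
    ≡⟨ cong length (filter-filter (inS α n) (nUnitBlocks n) W) ⟩
      length (filterᵇ (λ p → inS α n p ∧ nUnitBlocks n p) W)
    ≡⟨ length-filter (λ p → inS α n p ∧ nUnitBlocks n p) W ⟩
      count (λ p → inS α n p ∧ nUnitBlocks n p) W
    ≡⟨ count-wordsOf-reverse (λ p → inS α n p ∧ nUnitBlocks n p) (upTo (suc L)) ⟩
      count (λ rs → inS α n (reverse rs) ∧ nUnitBlocks n (reverse rs)) W
    ≡⟨ count-cong (counted-reverse n) W ⟩
      count (good (n , α * n)) W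
    ≡⟨ count-good L n (α * n) ≤-refl ⟩
      paths n (α * n)
    ∎ where
      open ≡-Reasoning
      L = n + α * n
      W = wordsUpTo L

  ballot : 1 ≤ α → ∀ b a → suc b * paths a b ≡ (suc b ∸ α * a) * (2 ^ a * (suc b C a))
  ballot _ b zero =
    trans (cong (suc b *_) (paths-axis b)) (cong (λ z → (suc b ∸ z) * 1) (sym (*-zeroʳ α)))
  ballot α≥1 zero (suc a) =
    trans (cong (1 *_) (paths-floor a)) (sym (cong (_* (2 ^ suc a * (1 C suc a))) (m≤n⇒m∸n≡0 (≤-trans α≥1 (m≤m*n α (suc a))))))
  ballot α≥1 (suc b) (suc a) with α * suc a ≤? suc b
  ... | no below = trans (cong (suc (suc b) *_) (paths-below (suc a) b below))
    (trans (*-zeroʳ (suc (suc b))) (sym (cong (_* (2 ^ suc a * (suc (suc b) C suc a))) (m≤n⇒m∸n≡0 (≰⇒> below)))))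
  ... | yes le = *-cancelˡ-≡ _ _ (suc b) (begin
      suc b * (suc (suc b) * paths (suc a) (suc b))
    ≡⟨ cong (λ z → suc b * (suc (suc b) * z)) (paths-step a b le) ⟩
      suc b * (suc (suc b) * (paths (suc a) b + 2 * paths a b))
    ≡⟨ ballot-step α a s (suc b) (paths (suc a) b) (paths a b) height
         (trans (ballot α≥1 b (suc a)) (cong (_* (2 ^ suc a * (suc b C suc a))) gap))
         (trans (ballot α≥1 b a) (cong (_* (2 ^ a * (suc b C a))) gap′)) ⟩
      suc b * (suc s * (2 ^ suc a * (suc (suc b) C suc a)))
    ≡⟨ cong (λ z → suc b * (z * (2 ^ suc a * (suc (suc b) C suc a)))) (sym gap″) ⟩
      suc b * ((suc (suc b) ∸ α * suc a) * (2 ^ suc a * (suc (suc b) C suc a)))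
    ∎)
    where
      open ≡-Reasoning
      s : ℕ
      s = proj₁ (m≤n⇒∃[o]m+o≡n le)
      height : α * suc a + s ≡ suc b
      height = proj₂ (m≤n⇒∃[o]m+o≡n le)
      gap : suc b ∸ α * suc a ≡ s
      gap = trans (cong (_∸ α * suc a) (sym height)) (m+n∸m≡n (α * suc a) s)
      gap′ : suc b ∸ α * a ≡ α + s
      gap′ = begin
          suc b ∸ α * a
        ≡⟨ cong (_∸ α * a) (sym height) ⟩
          α * suc a + s ∸ α * a
        ≡⟨ cong (λ z → z + s ∸ α * a) (*-suc α a) ⟩
          α + α * a + s ∸ α * a
        ≡⟨ cong (_∸ α * a) (regroup α (α * a) s) ⟩
          α * a + (α + s) ∸ α * a
        ≡⟨ m+n∸m≡n (α * a) (α + s) ⟩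
          α + s
        ∎ where
          regroup : ∀ x y z → x + y + z ≡ y + (x + z)
          regroup = solve-∀
      gap″ : suc (suc b) ∸ α * suc a ≡ suc s
      gap″ = trans (cong (λ z → suc z ∸ α * suc a) (trans (sym height) (+-comm (α * suc a) s)))
                   (m+n∸n≡m (suc s) (α * suc a))

scaled-count : ∀ α n → 1 ≤ α → suc (α * n) * countUnitBlocks α n ≡ 2 ^ n * (suc (α * n) C n)
scaled-count α n α≥1 = begin
    suc m * countUnitBlocks α n
  ≡⟨ cong (suc m *_) (countUnitBlocks≡paths n) ⟩
    suc m * paths n m
  ≡⟨ ballot α≥1 m n ⟩
    (suc m ∸ m) * X
  ≡⟨ cong (_* X) (m+n∸n≡m 1 m) ⟩
    1 * X
  ≡⟨ *-identityˡ X ⟩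
    X
  ∎ where
    open ≡-Reasoning
    open Reversed α
    m = α * n
    X = 2 ^ n * (suc m C n)

*-exchange : ∀ x y z → x * (y * z) ≡ y * (x * z)
*-exchange = solve-∀

divide-by-succ : ∀ m k p T → suc m * T ≡ p * (suc m C suc k) → suc k * T ≡ p * (m C k)
divide-by-succ m k p T h = *-cancelˡ-≡ _ _ (suc m) (begin
    suc m * (suc k * T)
  ≡⟨ *-exchange (suc m) (suc k) T ⟩
    suc k * (suc m * T)
  ≡⟨ cong (suc k *_) h ⟩
    suc k * (p * (suc m C suc k))
  ≡⟨ *-exchange (suc k) p _ ⟩
    p * (suc k * (suc m C suc k))
  ≡⟨ cong (p *_) (absorption m k) ⟩
    p * (suc m * (m C k))
  ≡⟨ *-exchange p (suc m) _ ⟩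
    suc m * (p * (m C k))
  ∎)
  where open ≡-Reasoning

shift-binomial : ∀ k d m p T → k + d ≡ m → suc k * T ≡ p * (m C k) → d * T ≡ p * (m C suc k)
shift-binomial k d m p T refl h = *-cancelˡ-≡ _ _ (suc k) (begin
    suc k * (d * T)
  ≡⟨ *-exchange (suc k) d T ⟩
    d * (suc k * T)
  ≡⟨ cong (d *_) h ⟩
    d * (p * (m C k))
  ≡⟨ *-exchange d p _ ⟩
    p * (d * (m C k))
  ≡⟨ cong (p *_) (sym (binomial-ratio k d)) ⟩
    p * (suc k * (m C suc k))
  ≡⟨ *-exchange p (suc k) _ ⟩
    suc k * (p * (m C suc k))
  ∎)
  where open ≡-Reasoning

corollary3p2 : (α n : ℕ) → 1 ≤ α → 1 ≤ n →
    (n * countUnitBlocks α n ≡ 2 ^ n * ((α * n) C (n ∸ 1)))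
    × (((α ∸ 1) * n + 1) * countUnitBlocks α n ≡ 2 ^ n * ((α * n) C n))
corollary3p2 (suc κ) (suc n′) α≥1 _ = first , second
  where
    α = suc κ
    n = suc n′
    first : n * countUnitBlocks α n ≡ 2 ^ n * ((α * n) C n′)
    first = divide-by-succ (α * n) n′ (2 ^ n) (countUnitBlocks α n) (scaled-count α n α≥1)
    split : n′ + (κ * n + 1) ≡ α * n
    split = rearrange κ n′
      where
        rearrange : ∀ κ n′ → n′ + (κ * suc n′ + 1) ≡ suc κ * suc n′
        rearrange = solve-∀
    second : (κ * n + 1) * countUnitBlocks α n ≡ 2 ^ n * ((α * n) C n)
    second = shift-binomial n′ (κ * n + 1) (α * n) (2 ^ n) (countUnitBlocks α n) split first
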